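{- If a focused hypersequent $[p]G$ is derivable in $\mathbf{GA_t}$, then $\models_{\mathbf{A}} G$.
   Context: Formulas are built from propositional variables and $t$ using $+,\to,\land,\lor,\lnot$. A sequent (component) is a pair of finite multisets $\Gamma\vdash\Delta$; a hypersequent a finite multiset of components. $\models_{\mathbf{A}}G$ means: for every valuation into $\mathbb{Q}$ ($t=0$, $+$ addition, $\lnot$ negation, $A\to B$ valued $v(B)-v(A)$, $\land=\min$, $\lor=\max$) some component $\Gamma_i\vdash\Delta_i$ of $G$ has $\sum v(\Gamma_i)\le\sum v(\Delta_i)$ (empty sum $0$). A focused hypersequent $[q]G$ is a hypersequent $G$ together with a propositional variable $q$. $m\Gamma$ is $m$ copies of $\Gamma$, $np$ is $n$ copies of $p$; "atomic" means consisting of propositional variables. Calculus $\mathbf{GA_t}$ (same focus $[q]$ in premises and conclusion unless stated; each logical rule carries a side hypersequent $[q]G\mid$): axioms $[q]A\vdash A$ and $[q]\vdash$; (EW) from $[q]G\mid\Gamma\vdash\Delta$ infer $[q]G\mid\Gamma\vdash\Delta\mid\Gamma'\vdash\Delta'$; (M) from $[q]G\mid\Gamma_1\vdash\Delta_1$ and $[q]G\mid\Gamma_2\vdash\Delta_2$ infer $[q]G\mid\Gamma_1,\Gamma_2\vdash\Delta_1,\Delta_2$; logical rules $(t,l)$ $\Gamma\vdash\Delta/\Gamma,t\vdash\Delta$; $(t,r)$ $\Gamma\vdash\Delta/\Gamma\vdash t,\Delta$; $(\lnot,l)$ $\Gamma\vdash A,\Delta/\Gamma,\lnot A\vdash\Delta$;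 $(\lnot,r)$ $\Gamma,A\vdash\Delta/\Gamma\vdash\lnot A,\Delta$; $(\to,l)$ $\Gamma,B\vdash A,\Delta/\Gamma,A\to B\vdash\Delta$; $(\to,r)$ $\Gamma,A\vdash B,\Delta/\Gamma\vdash A\to B,\Delta$; $(+,l)$ $\Gamma,A,B\vdash\Delta/\Gamma,A+B\vdash\Delta$; $(+,r)$ $\Gamma\vdash A,B,\Delta/\Gamma\vdash A+B,\Delta$; $(\land,l)$ $\Gamma,A\vdash\Delta\mid\Gamma,B\vdash\Delta/\Gamma,A\land B\vdash\Delta$; $(\land,r)$ premises $\Gamma\vdash A,\Delta$ and $\Gamma\vdash B,\Delta$, conclusion $\Gamma\vdash A\land B,\Delta$; $(\lor,l)$ premises $\Gamma,A\vdash\Delta$ and $\Gamma,B\vdash\Delta$, conclusion $\Gamma,A\lor B\vdash\Delta$; $(\lor,r)$ $\Gamma\vdash A,\Delta\mid\Gamma\vdash B,\Delta/\Gamma\vdash A\lor B,\Delta$; (shift) from $[q]G$ infer $[p]G$ provided $q$ occurs in $G$ and $p$ does not; (S') from $[p]G\mid m\Gamma_1,n\Gamma_2\vdash m\Delta_1,n\Delta_2\mid S$ infer $[p]G\mid\Gamma_1,np\vdash\Delta_1\mid\Gamma_2\vdash\Delta_2,mp$, provided $\Gamma_1,\Gamma_2,\Delta_1,\Delta_2$ atomic, $n,m>0$, $p$ not in $\Gamma_1,\Delta_1,\Gamma_2,\Delta_2$, and $S$ is $\Gamma_1,np\vdash\Delta_1$ or $\Gamma_2\vdash\Delta_2,mp$.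 -}

module Defs where

open import Data.Nat using (ℕ; suc; _<_)
open import Data.List using (List; []; _∷_; _++_; map; foldr; replicate; concat)
open import Data.List.Relation.Unary.All using (All)
open import Data.List.Relation.Unary.Any using (Any)
open import Data.List.Relation.Binary.Permutation.Propositional using (_↭_)
open import Data.Product using (_×_)
open import Data.Sum using (_⊎_)
open import Relation.Binary.PropositionalEquality using (_≡_)
open import Relation.Nullary using (¬_)
open import Data.Rational as Q using (ℚ; 0ℚ)

data Fm : Set where
  var  : ℕ → Fm
  tt   : Fm
  _⊕_  : Fm → Fm → Fm
  _⇒_  : Fm → Fm → Fm
  _∧_  : Fm → Fm → Fm
  _∨_  : Fm → Fm → Fm
  ~_   : Fm → Fm

-- Multisets are represented by lists; rules Ex-S / Ex-H below make
-- derivability invariant under reordering (i.e. multiset semantics).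
Mset : Set
Mset = List Fm

infix 4 _⊢_
data Seq : Set where
  _⊢_ : Mset → Mset → Seq

Hyp : Set
Hyp = List Seq

data OccF (p : ℕ) : Fm → Set where
  here  : OccF p (var p)
  ⊕l : ∀ {A B} → OccF p A → OccF p (A ⊕ B)
  ⊕r : ∀ {A B} → OccF p B → OccF p (A ⊕ B)
  ⇒l : ∀ {A B} → OccF p A → OccF p (A ⇒ B)
  ⇒r : ∀ {A B} → OccF p B → OccF p (A ⇒ B)
  ∧l : ∀ {A B} → OccF p A → OccF p (A ∧ B)
  ∧r : ∀ {A B} → OccF p B → OccF p (A ∧ B)
  ∨l : ∀ {A B} → OccF p A → OccF p (A ∨ B)
  ∨r : ∀ {A B} → OccF p B → OccF p (A ∨ B)
  ~o : ∀ {A} → OccF p A → OccF p (~ A)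

OccM : ℕ → Mset → Set
OccM p Γ = Any (OccF p) Γ

OccS : ℕ → Seq → Set
OccS p (Γ ⊢ Δ) = OccM p Γ ⊎ OccM p Δ

OccH : ℕ → Hyp → Set
OccH p G = Any (OccS p) G

data IsVar : Fm → Set where
  isVar : ∀ n → IsVar (var n)

Atomic : Mset → Set
Atomic Γ = All IsVar Γ

_·_ : ℕ → Mset → Mset
m · Γ = concat (replicate m Γ)

_copies_ : ℕ → ℕ → Mset
n copies p = replicate n (var p)

-- The calculus GA_t; focused hypersequent [q]G is written  GA q G.
-- The side hypersequent G of each rule is the tail of the list.

data GA : ℕ → Hyp → Set where
  ex-H : ∀ {q G G'} → G ↭ G' → GA q G → GA q G'
  ex-S : ∀ {q G Γ Γ' Δ Δ'} → Γ ↭ Γ' → Δ ↭ Δ' →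
         GA q ((Γ ⊢ Δ) ∷ G) → GA q ((Γ' ⊢ Δ') ∷ G)
  ax   : ∀ {q} A → GA q ((A ∷ [] ⊢ A ∷ []) ∷ [])
  ax∅  : ∀ {q} → GA q (([] ⊢ []) ∷ [])
  EW   : ∀ {q G Γ Δ Γ' Δ'} → GA q ((Γ ⊢ Δ) ∷ G) →
         GA q ((Γ' ⊢ Δ') ∷ (Γ ⊢ Δ) ∷ G)
  M    : ∀ {q G Γ₁ Δ₁ Γ₂ Δ₂} → GA q ((Γ₁ ⊢ Δ₁) ∷ G) → GA q ((Γ₂ ⊢ Δ₂) ∷ G) →
         GA q ((Γ₁ ++ Γ₂ ⊢ Δ₁ ++ Δ₂) ∷ G)
  t-l  : ∀ {q G Γ Δ} → GA q ((Γ ⊢ Δ) ∷ G) → GA q ((tt ∷ Γ ⊢ Δ) ∷ G)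
  t-r  : ∀ {q G Γ Δ} → GA q ((Γ ⊢ Δ) ∷ G) → GA q ((Γ ⊢ tt ∷ Δ) ∷ G)
  ~-l  : ∀ {q G Γ Δ A} → GA q ((Γ ⊢ A ∷ Δ) ∷ G) → GA q ((~ A ∷ Γ ⊢ Δ) ∷ G)
  ~-r  : ∀ {q G Γ Δ A} → GA q ((A ∷ Γ ⊢ Δ) ∷ G) → GA q ((Γ ⊢ ~ A ∷ Δ) ∷ G)
  ⇒-l  : ∀ {q G Γ Δ A B} → GA q ((B ∷ Γ ⊢ A ∷ Δ) ∷ G) → GA q ((A ⇒ B ∷ Γ ⊢ Δ) ∷ G)
  ⇒-r  : ∀ {q G Γ Δ A B} → GA q ((A ∷ Γ ⊢ B ∷ Δ) ∷ G) → GA q ((Γ ⊢ A ⇒ B ∷ Δ) ∷ G)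
  ⊕-l  : ∀ {q G Γ Δ A B} → GA q ((A ∷ B ∷ Γ ⊢ Δ) ∷ G) → GA q ((A ⊕ B ∷ Γ ⊢ Δ) ∷ G)
  ⊕-r  : ∀ {q G Γ Δ A B} → GA q ((Γ ⊢ A ∷ B ∷ Δ) ∷ G) → GA q ((Γ ⊢ A ⊕ B ∷ Δ) ∷ G)
  ∧-l  : ∀ {q G Γ Δ A B} → GA q ((A ∷ Γ ⊢ Δ) ∷ (B ∷ Γ ⊢ Δ) ∷ G) →
         GA q ((A ∧ B ∷ Γ ⊢ Δ) ∷ G)
  ∧-r  : ∀ {q G Γ Δ A B} → GA q ((Γ ⊢ A ∷ Δ) ∷ G) → GA q ((Γ ⊢ B ∷ Δ) ∷ G) →
         GA q ((Γ ⊢ A ∧ B ∷ Δ) ∷ G)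
  ∨-l  : ∀ {q G Γ Δ A B} → GA q ((A ∷ Γ ⊢ Δ) ∷ G) → GA q ((B ∷ Γ ⊢ Δ) ∷ G) →
         GA q ((A ∨ B ∷ Γ ⊢ Δ) ∷ G)
  ∨-r  : ∀ {q G Γ Δ A B} → GA q ((Γ ⊢ A ∷ Δ) ∷ (Γ ⊢ B ∷ Δ) ∷ G) →
         GA q ((Γ ⊢ A ∨ B ∷ Δ) ∷ G)
  shift : ∀ {q p G} → OccH q G → ¬ OccH p G → GA q G → GA p G
  S'₁  : ∀ {p G Γ₁ Γ₂ Δ₁ Δ₂} (m n : ℕ) → 0 < m → 0 < n →
         Atomic Γ₁ → Atomic Γ₂ → Atomic Δ₁ → Atomic Δ₂ →
         ¬ OccM p Γ₁ → ¬ OccM p Δ₁ → ¬ OccM p Γ₂ → ¬ OccM p Δ₂ →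
         GA p ((m · Γ₁ ++ n · Γ₂ ⊢ m · Δ₁ ++ n · Δ₂) ∷
               (Γ₁ ++ n copies p ⊢ Δ₁) ∷ G) →
         GA p ((Γ₁ ++ n copies p ⊢ Δ₁) ∷ (Γ₂ ⊢ Δ₂ ++ m copies p) ∷ G)
  S'₂  : ∀ {p G Γ₁ Γ₂ Δ₁ Δ₂} (m n : ℕ) → 0 < m → 0 < n →
         Atomic Γ₁ → Atomic Γ₂ → Atomic Δ₁ → Atomic Δ₂ →
         ¬ OccM p Γ₁ → ¬ OccM p Δ₁ → ¬ OccM p Γ₂ → ¬ OccM p Δ₂ →
         GA p ((m · Γ₁ ++ n · Γ₂ ⊢ m · Δ₁ ++ n · Δ₂) ∷
               (Γ₂ ⊢ Δ₂ ++ m copies p) ∷ G) →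
         GA p ((Γ₁ ++ n copies p ⊢ Δ₁) ∷ (Γ₂ ⊢ Δ₂ ++ m copies p) ∷ G)

-- Semantics in the ordered group (ℚ,+,≤)

Val : Set
Val = ℕ → ℚ

⟦_⟧ : Fm → Val → ℚ
⟦ var n ⟧ v = v n
⟦ tt ⟧ v = 0ℚ
⟦ A ⊕ B ⟧ v = ⟦ A ⟧ v Q.+ ⟦ B ⟧ v
⟦ A ⇒ B ⟧ v = ⟦ B ⟧ v Q.- ⟦ A ⟧ v
⟦ A ∧ B ⟧ v = ⟦ A ⟧ v Q.⊓ ⟦ B ⟧ v
⟦ A ∨ B ⟧ v = ⟦ A ⟧ v Q.⊔ ⟦ B ⟧ v
⟦ ~ A ⟧ v = Q.- (⟦ A ⟧ v)

Σ⟦_⟧ : Mset → Val → ℚ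
Σ⟦ Γ ⟧ v = foldr (λ A r → ⟦ A ⟧ v Q.+ r) 0ℚ Γ

SeqTrue : Val → Seq → Set
SeqTrue v (Γ ⊢ Δ) = Σ⟦ Γ ⟧ v Q.≤ Σ⟦ Δ ⟧ v

⊨A : Hyp → Set
⊨A G = ∀ (v : Val) → Any (SeqTrue v) G

-- Under a valuation v, give each component Γ ⊢ Δ its balance ΣΔ − ΣΓ, so the component is true
-- iff its balance is nonnegative.  For every rule the balance of the active conclusion component
-- is computed from the balances of the active premise components by an operation under which
-- nonnegativity propagates: equality for the structural and invertible rules, + for (M), ⊓ for
-- (∧,r) and (∨,l), and ⊔ for (∧,l) and (∨,r).  For (S') the premise has balance m·β₁ + n·β₂,
-- where β₁, β₂ are the balances of the two conclusion components (the contributions m·n·v(p)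
-- of p cancel), so it is negative as soon as both β₁ and β₂ are.
module Submission where

open import Defs
open import Data.Nat using (ℕ; zero; suc)
import Data.Nat as ℕ
import Data.Nat.Properties as ℕ
open import Data.List using ([]; _∷_; _++_)
open import Data.List.Relation.Unary.Any as Any using (Any; here; there)
open import Data.List.Relation.Binary.Permutation.Propositional as ↭ using (_↭_)
open import Data.List.Relation.Binary.Permutation.Propositional.Properties using (Any-resp-↭)
open import Data.Rational using (ℚ; 0ℚ; _≤_; _≥_; _<_; _+_; _-_; -_; _⊓_; _⊔_)
open import Data.Rational.Properties
open import Data.Rational.Solver using (module +-*-Solver)
open +-*-Solver using (solve; _:=_; _:+_; _:-_; :-_)
open import Algebra.Properties.CommutativeMonoid.Mult +-0-commutativeMonoid using (_×_; ×-distrib-+; ×-assocˡ)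
open import Data.Sum as Sum using (_⊎_; inj₁; inj₂; [_,_]′)
open import Function using (_∘_)
open import Relation.Binary.PropositionalEquality using (_≡_; refl; cong; cong₂; sym; trans; subst; module ≡-Reasoning)
open import Relation.Nullary using (yes; no; contradiction)
open import Relation.Binary.Definitions using (Monotonic₁)

×-distrib-neg : ∀ m x → m × (- x) ≡ - (m × x)
×-distrib-neg zero x = refl
×-distrib-neg (suc m) x = begin
  - x + m × (- x)  ≡⟨ cong (- x +_) (×-distrib-neg m x) ⟩
  - x + - (m × x)  ≡⟨ sym (neg-distrib-+ x (m × x)) ⟩
  - (x + m × x)    ∎
  where open ≡-Reasoning

×-distrib-− : ∀ m x y → m × (x - y) ≡ m × x - m × y
×-distrib-− m x y = begin
  m × (x - y)          ≡⟨ ×-distrib-+ x (- y) m ⟩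
  m × x + m × (- y)    ≡⟨ cong (m × x +_) (×-distrib-neg m y) ⟩
  m × x - m × y        ∎
  where open ≡-Reasoning

×-comm : ∀ m n x → m × (n × x) ≡ n × (m × x)
×-comm m n x = begin
  m × (n × x)      ≡⟨ ×-assocˡ x m n ⟩
  (m ℕ.* n) × x    ≡⟨ cong (_× x) (ℕ.*-comm m n) ⟩
  (n ℕ.* m) × x    ≡⟨ sym (×-assocˡ x n m) ⟩
  n × (m × x)      ∎
  where open ≡-Reasoning

×-pres-≤0 : ∀ m {x} → x ≤ 0ℚ → m × x ≤ 0ℚ
×-pres-≤0 zero    x≤0 = ≤-refl
×-pres-≤0 (suc m) x≤0 = +-mono-≤ x≤0 (×-pres-≤0 m x≤0)

×-pres-<0 : ∀ {m x} → 0 ℕ.< m → x < 0ℚ → m × x < 0ℚ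
×-pres-<0 {suc m} _ x<0 = +-mono-<-≤ x<0 (×-pres-≤0 m (<⇒≤ x<0))

scaled-sum-nonNeg⇒nonNeg : ∀ {m n x y} → 0 ℕ.< m → 0 ℕ.< n →
                    0ℚ ≤ m × x + n × y → 0ℚ ≤ x ⊎ 0ℚ ≤ y
scaled-sum-nonNeg⇒nonNeg {m} {n} {x} {y} 0<m 0<n 0≤sum with 0ℚ ≤? x | 0ℚ ≤? y
... | yes 0≤x | _       = inj₁ 0≤x
... | no _    | yes 0≤y = inj₂ 0≤y
... | no 0≰x  | no 0≰y  = contradiction (≤-<-trans 0≤sum sum<0) (<-irrefl refl)
  where
  sum<0 : m × x + n × y < 0ℚ
  sum<0 = +-mono-< (×-pres-<0 0<m (≰⇒> 0≰x)) (×-pres-<0 0<n (≰⇒> 0≰y))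

×-cross-cancel : ∀ m n d₁ g₁ d₂ g₂ x →
                 m × (d₁ - (g₁ + n × x)) + n × ((d₂ + m × x) - g₂) ≡ (m × d₁ + n × d₂) - (m × g₁ + n × g₂)
×-cross-cancel m n d₁ g₁ d₂ g₂ x = begin
  m × (d₁ - (g₁ + n × x)) + n × ((d₂ + m × x) - g₂)
    ≡⟨ cong₂ _+_ (×-distrib-− m d₁ _) (×-distrib-− n _ g₂) ⟩
  (m × d₁ - m × (g₁ + n × x)) + (n × (d₂ + m × x) - n × g₂)
    ≡⟨ cong₂ (λ a b → (m × d₁ - a) + (b - n × g₂)) (×-distrib-+ g₁ (n × x) m) (×-distrib-+ d₂ (m × x) n) ⟩
  (m × d₁ - (m × g₁ + m × (n × x))) + ((n × d₂ + n × (m × x)) - n × g₂)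
    ≡⟨ cong (λ c → (m × d₁ - (m × g₁ + c)) + ((n × d₂ + n × (m × x)) - n × g₂)) (×-comm m n x) ⟩
  (m × d₁ - (m × g₁ + n × (m × x))) + ((n × d₂ + n × (m × x)) - n × g₂)
    ≡⟨ solve 5 (λ D₁ G₁ D₂ G₂ c → (D₁ :- (G₁ :+ c)) :+ ((D₂ :+ c) :- G₂) := (D₁ :+ D₂) :- (G₁ :+ G₂))
               refl (m × d₁) (m × g₁) (n × d₂) (n × g₂) (n × (m × x)) ⟩
  (m × d₁ + n × d₂) - (m × g₁ + n × g₂)
    ∎
  where open ≡-Reasoning

0≤q-p⇒p≤q : ∀ {p q} → 0ℚ ≤ q - p → p ≤ q
0≤q-p⇒p≤q {p} {q} 0≤q-p = begin
  p              ≡⟨ +-identityˡ p ⟨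
  0ℚ + p         ≤⟨ +-monoˡ-≤ p 0≤q-p ⟩
  (q - p) + p    ≡⟨ solve 2 (λ p q → (q :- p) :+ p := q) refl p q ⟩
  q              ∎
  where open ≤-Reasoning

−[+]-antitone : ∀ d g → Monotonic₁ _≤_ _≥_ (λ x → d - (x + g))
−[+]-antitone d g x≤y = +-monoʳ-≤ d (neg-antimono-≤ (+-monoˡ-≤ g x≤y))

[+]−-monotone : ∀ d g → Monotonic₁ _≤_ _≤_ (λ x → (x + d) - g)
[+]−-monotone d g x≤y = +-monoˡ-≤ (- g) (+-monoˡ-≤ d x≤y)

module _ (v : Val) where

  Σ-++ : ∀ Γ Δ → Σ⟦ Γ ++ Δ ⟧ v ≡ Σ⟦ Γ ⟧ v + Σ⟦ Δ ⟧ v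
  Σ-++ []      Δ = sym (+-identityˡ _)
  Σ-++ (A ∷ Γ) Δ = trans (cong (⟦ A ⟧ v +_) (Σ-++ Γ Δ)) (sym (+-assoc (⟦ A ⟧ v) _ _))

  Σ-· : ∀ m Γ → Σ⟦ m · Γ ⟧ v ≡ m × Σ⟦ Γ ⟧ v
  Σ-· zero    Γ = refl
  Σ-· (suc m) Γ = trans (Σ-++ Γ (m · Γ)) (cong (Σ⟦ Γ ⟧ v +_) (Σ-· m Γ))

  Σ-copies : ∀ n p → Σ⟦ n copies p ⟧ v ≡ n × v p
  Σ-copies zero    p = refl
  Σ-copies (suc n) p = cong (v p +_) (Σ-copies n p)

  Σ-↭ : ∀ {Γ Δ} → Γ ↭ Δ → Σ⟦ Γ ⟧ v ≡ Σ⟦ Δ ⟧ v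
  Σ-↭ ↭.refl                  = refl
  Σ-↭ (↭.prep A π)            = cong (⟦ A ⟧ v +_) (Σ-↭ π)
  Σ-↭ (↭.swap {ys = Δ} A B π) = trans (cong (λ s → ⟦ A ⟧ v + (⟦ B ⟧ v + s)) (Σ-↭ π))
    (solve 3 (λ a b s → a :+ (b :+ s) := b :+ (a :+ s)) refl (⟦ A ⟧ v) (⟦ B ⟧ v) (Σ⟦ Δ ⟧ v))
  Σ-↭ (↭.trans π ρ)           = trans (Σ-↭ π) (Σ-↭ ρ)

  balance : Seq → ℚ
  balance (Γ ⊢ Δ) = Σ⟦ Δ ⟧ v - Σ⟦ Γ ⟧ v

  -- A record rather than a synonym, so that Holds s determines s and the rule lemmas below can
  -- leave all sequent data implicit.
  record Holds (s : Seq) : Set where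
    constructor holds
    field nonNeg : 0ℚ ≤ balance s
  open Holds

  Holds⇒SeqTrue : ∀ {s} → Holds s → SeqTrue v s
  Holds⇒SeqTrue {Γ ⊢ Δ} h = 0≤q-p⇒p≤q (nonNeg h)

  Holds-refl : ∀ Γ → Holds (Γ ⊢ Γ)
  Holds-refl Γ = holds (≤-reflexive (sym (+-inverseʳ (Σ⟦ Γ ⟧ v))))

  holds-by : ∀ {s q} → balance s ≡ q → 0ℚ ≤ q → Holds s
  holds-by eq 0≤q = holds (subst (0ℚ ≤_) (sym eq) 0≤q)

  Holds-≡ : ∀ {s s'} → balance s ≡ balance s' → Holds s' → Holds s
  Holds-≡ eq h = holds-by eq (nonNeg h)

  Holds-+ : ∀ {s s₁ s₂} → balance s ≡ balance s₁ + balance s₂ → Holds s₁ → Holds s₂ → Holds s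
  Holds-+ eq h₁ h₂ = holds-by eq (+-mono-≤ (nonNeg h₁) (nonNeg h₂))

  Holds-⊓ : ∀ {s s₁ s₂} → balance s ≡ balance s₁ ⊓ balance s₂ → Holds s₁ → Holds s₂ → Holds s
  Holds-⊓ eq h₁ h₂ = holds-by eq (⊓-glb (nonNeg h₁) (nonNeg h₂))

  Holds-⊔ : ∀ {s s₁ s₂} → balance s ≡ balance s₁ ⊔ balance s₂ → Holds s₁ ⊎ Holds s₂ → Holds s
  Holds-⊔ {s₁ = s₁} {s₂} eq (inj₁ h₁) = holds-by eq (≤-trans (nonNeg h₁) (p≤p⊔q (balance s₁) (balance s₂)))
  Holds-⊔ {s₁ = s₁} {s₂} eq (inj₂ h₂) = holds-by eq (≤-trans (nonNeg h₂) (p≤q⊔p (balance s₁) (balance s₂)))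

  Holds-× : ∀ {s s₁ s₂ m n} → 0 ℕ.< m → 0 ℕ.< n → balance s ≡ m × balance s₁ + n × balance s₂ →
            Holds s → Holds s₁ ⊎ Holds s₂
  Holds-× 0<m 0<n eq h = Sum.map holds holds (scaled-sum-nonNeg⇒nonNeg 0<m 0<n (subst (0ℚ ≤_) eq (nonNeg h)))

  module _ {Γ Δ : Mset} where

    private
      g = Σ⟦ Γ ⟧ v
      d = Σ⟦ Δ ⟧ v

    t-l-sound : Holds (Γ ⊢ Δ) → Holds (tt ∷ Γ ⊢ Δ)
    t-l-sound = Holds-≡ (cong (λ x → d - x) (+-identityˡ g))

    t-r-sound : Holds (Γ ⊢ Δ) → Holds (Γ ⊢ tt ∷ Δ)
    t-r-sound = Holds-≡ (cong (_- g) (+-identityˡ d))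

    ~-l-sound : ∀ {A} → Holds (Γ ⊢ A ∷ Δ) → Holds (~ A ∷ Γ ⊢ Δ)
    ~-l-sound {A} = Holds-≡ (solve 3 (λ a g d → d :- (:- a :+ g) := (a :+ d) :- g) refl (⟦ A ⟧ v) g d)

    ~-r-sound : ∀ {A} → Holds (A ∷ Γ ⊢ Δ) → Holds (Γ ⊢ ~ A ∷ Δ)
    ~-r-sound {A} = Holds-≡ (solve 3 (λ a g d → (:- a :+ d) :- g := d :- (a :+ g)) refl (⟦ A ⟧ v) g d)

    ⇒-l-sound : ∀ {A B} → Holds (B ∷ Γ ⊢ A ∷ Δ) → Holds (A ⇒ B ∷ Γ ⊢ Δ)
    ⇒-l-sound {A} {B} = Holds-≡
      (solve 4 (λ a b g d → d :- ((b :- a) :+ g) := (a :+ d) :- (b :+ g)) refl (⟦ A ⟧ v) (⟦ B ⟧ v) g d)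

    ⇒-r-sound : ∀ {A B} → Holds (A ∷ Γ ⊢ B ∷ Δ) → Holds (Γ ⊢ A ⇒ B ∷ Δ)
    ⇒-r-sound {A} {B} = Holds-≡
      (solve 4 (λ a b g d → ((b :- a) :+ d) :- g := (b :+ d) :- (a :+ g)) refl (⟦ A ⟧ v) (⟦ B ⟧ v) g d)

    ⊕-l-sound : ∀ {A B} → Holds (A ∷ B ∷ Γ ⊢ Δ) → Holds (A ⊕ B ∷ Γ ⊢ Δ)
    ⊕-l-sound {A} {B} = Holds-≡ (cong (λ x → d - x) (+-assoc (⟦ A ⟧ v) (⟦ B ⟧ v) g))

    ⊕-r-sound : ∀ {A B} → Holds (Γ ⊢ A ∷ B ∷ Δ) → Holds (Γ ⊢ A ⊕ B ∷ Δ)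
    ⊕-r-sound {A} {B} = Holds-≡ (cong (_- g) (+-assoc (⟦ A ⟧ v) (⟦ B ⟧ v) d))

    ∧-l-sound : ∀ {A B} → Holds (A ∷ Γ ⊢ Δ) ⊎ Holds (B ∷ Γ ⊢ Δ) → Holds (A ∧ B ∷ Γ ⊢ Δ)
    ∧-l-sound {A} {B} = Holds-⊔ (antimono-≤-distrib-⊓ (−[+]-antitone d g) (⟦ A ⟧ v) (⟦ B ⟧ v))

    ∨-l-sound : ∀ {A B} → Holds (A ∷ Γ ⊢ Δ) → Holds (B ∷ Γ ⊢ Δ) → Holds (A ∨ B ∷ Γ ⊢ Δ)
    ∨-l-sound {A} {B} = Holds-⊓ (antimono-≤-distrib-⊔ (−[+]-antitone d g) (⟦ A ⟧ v) (⟦ B ⟧ v))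

    ∧-r-sound : ∀ {A B} → Holds (Γ ⊢ A ∷ Δ) → Holds (Γ ⊢ B ∷ Δ) → Holds (Γ ⊢ A ∧ B ∷ Δ)
    ∧-r-sound {A} {B} = Holds-⊓ (mono-≤-distrib-⊓ ([+]−-monotone d g) (⟦ A ⟧ v) (⟦ B ⟧ v))

    ∨-r-sound : ∀ {A B} → Holds (Γ ⊢ A ∷ Δ) ⊎ Holds (Γ ⊢ B ∷ Δ) → Holds (Γ ⊢ A ∨ B ∷ Δ)
    ∨-r-sound {A} {B} = Holds-⊔ (mono-≤-distrib-⊔ ([+]−-monotone d g) (⟦ A ⟧ v) (⟦ B ⟧ v))

  ex-S-sound : ∀ {Γ Γ' Δ Δ'} → Γ ↭ Γ' → Δ ↭ Δ' → Holds (Γ ⊢ Δ) → Holds (Γ' ⊢ Δ')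
  ex-S-sound π ρ = Holds-≡ (cong₂ _-_ (sym (Σ-↭ ρ)) (sym (Σ-↭ π)))

  M-sound : ∀ {Γ₁ Δ₁ Γ₂ Δ₂} → Holds (Γ₁ ⊢ Δ₁) → Holds (Γ₂ ⊢ Δ₂) → Holds (Γ₁ ++ Γ₂ ⊢ Δ₁ ++ Δ₂)
  M-sound {Γ₁} {Δ₁} {Γ₂} {Δ₂} = Holds-+ (begin
    Σ⟦ Δ₁ ++ Δ₂ ⟧ v - Σ⟦ Γ₁ ++ Γ₂ ⟧ v  ≡⟨ cong₂ _-_ (Σ-++ Δ₁ Δ₂) (Σ-++ Γ₁ Γ₂) ⟩
    (d₁ + d₂) - (g₁ + g₂)              ≡⟨ solve 4 (λ g₁ d₁ g₂ d₂ → (d₁ :+ d₂) :- (g₁ :+ g₂) := (d₁ :- g₁) :+ (d₂ :- g₂))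
                                                  refl g₁ d₁ g₂ d₂ ⟩
    (d₁ - g₁) + (d₂ - g₂)              ∎)
    where
    open ≡-Reasoning
    g₁ = Σ⟦ Γ₁ ⟧ v
    d₁ = Σ⟦ Δ₁ ⟧ v
    g₂ = Σ⟦ Γ₂ ⟧ v
    d₂ = Σ⟦ Δ₂ ⟧ v

  S'-sound : ∀ {Γ₁ Γ₂ Δ₁ Δ₂ p m n} → 0 ℕ.< m → 0 ℕ.< n →
             Holds (m · Γ₁ ++ n · Γ₂ ⊢ m · Δ₁ ++ n · Δ₂) →
             Holds (Γ₁ ++ n copies p ⊢ Δ₁) ⊎ Holds (Γ₂ ⊢ Δ₂ ++ m copies p)
  S'-sound {Γ₁} {Γ₂} {Δ₁} {Δ₂} {p} {m} {n} 0<m 0<n = Holds-× 0<m 0<n (begin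
    Σ⟦ m · Δ₁ ++ n · Δ₂ ⟧ v - Σ⟦ m · Γ₁ ++ n · Γ₂ ⟧ v
      ≡⟨ cong₂ _-_ (Σ-scaled Δ₁ Δ₂) (Σ-scaled Γ₁ Γ₂) ⟩
    (m × d₁ + n × d₂) - (m × g₁ + n × g₂)
      ≡⟨ ×-cross-cancel m n d₁ g₁ d₂ g₂ (v p) ⟨
    m × (d₁ - (g₁ + n × v p)) + n × ((d₂ + m × v p) - g₂)
      ≡⟨ cong₂ (λ a b → m × (d₁ - a) + n × (b - g₂)) (Σ-++-copies Γ₁ n) (Σ-++-copies Δ₂ m) ⟨
    m × balance (Γ₁ ++ n copies p ⊢ Δ₁) + n × balance (Γ₂ ⊢ Δ₂ ++ m copies p)
      ∎)
    where
    open ≡-Reasoning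
    g₁ = Σ⟦ Γ₁ ⟧ v
    d₁ = Σ⟦ Δ₁ ⟧ v
    g₂ = Σ⟦ Γ₂ ⟧ v
    d₂ = Σ⟦ Δ₂ ⟧ v

    Σ-scaled : ∀ Θ Λ → Σ⟦ m · Θ ++ n · Λ ⟧ v ≡ m × Σ⟦ Θ ⟧ v + n × Σ⟦ Λ ⟧ v
    Σ-scaled Θ Λ = trans (Σ-++ (m · Θ) (n · Λ)) (cong₂ _+_ (Σ-· m Θ) (Σ-· n Λ))

    Σ-++-copies : ∀ Θ k → Σ⟦ Θ ++ k copies p ⟧ v ≡ Σ⟦ Θ ⟧ v + k × v p
    Σ-++-copies Θ k = trans (Σ-++ Θ (k copies p)) (cong (Σ⟦ Θ ⟧ v +_) (Σ-copies k p))

  on-head : ∀ {s s' G} → (Holds s → Holds s') → Any Holds (s ∷ G) → Any Holds (s' ∷ G)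
  on-head f (here h)   = here (f h)
  on-head f (there hs) = there hs

  on-heads : ∀ {s₁ s₂ s G} → (Holds s₁ → Holds s₂ → Holds s) →
             Any Holds (s₁ ∷ G) → Any Holds (s₂ ∷ G) → Any Holds (s ∷ G)
  on-heads f (here h₁)  (here h₂)  = here (f h₁ h₂)
  on-heads f (there hs) _          = there hs
  on-heads f (here _)   (there hs) = there hs

  on-two-heads : ∀ {s₁ s₂ s G} → (Holds s₁ ⊎ Holds s₂ → Holds s) →
                 Any Holds (s₁ ∷ s₂ ∷ G) → Any Holds (s ∷ G)
  on-two-heads f (here h₁)          = here (f (inj₁ h₁))
  on-two-heads f (there (here h₂))  = here (f (inj₂ h₂))
  on-two-heads f (there (there hs)) = there hs

  sound : ∀ {q G} → GA q G → Any Holds G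
  sound (ex-H π d)    = Any-resp-↭ π (sound d)
  sound (ex-S π ρ d)  = on-head (ex-S-sound π ρ) (sound d)
  sound (ax A)        = here (Holds-refl (A ∷ []))
  sound ax∅           = here (Holds-refl [])
  sound (EW d)        = there (sound d)
  sound (M d e)       = on-heads M-sound (sound d) (sound e)
  sound (t-l d)       = on-head t-l-sound (sound d)
  sound (t-r d)       = on-head t-r-sound (sound d)
  sound (~-l d)       = on-head ~-l-sound (sound d)
  sound (~-r d)       = on-head ~-r-sound (sound d)
  sound (⇒-l d)       = on-head ⇒-l-sound (sound d)
  sound (⇒-r d)       = on-head ⇒-r-sound (sound d)
  sound (⊕-l d)       = on-head ⊕-l-sound (sound d)
  sound (⊕-r d)       = on-head ⊕-r-sound (sound d)
  sound (∧-l d)       = on-two-heads ∧-l-sound (sound d)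
  sound (∧-r d e)     = on-heads ∧-r-sound (sound d) (sound e)
  sound (∨-l d e)     = on-heads ∨-l-sound (sound d) (sound e)
  sound (∨-r d)       = on-two-heads ∨-r-sound (sound d)
  sound (shift _ _ d) = sound d
  sound (S'₁ m n 0<m 0<n _ _ _ _ _ _ _ _ d) with sound d
  ... | here h           = [ here , there ∘ here ]′ (S'-sound 0<m 0<n h)
  ... | there (here h₁)  = here h₁
  ... | there (there hs) = there (there hs)
  sound (S'₂ m n 0<m 0<n _ _ _ _ _ _ _ _ d) with sound d
  ... | here h           = [ here , there ∘ here ]′ (S'-sound 0<m 0<n h)
  ... | there (here h₂)  = there (here h₂)
  ... | there (there hs) = there (there hs)

mainTheorem9 : ∀ (p : ℕ) (G : Hyp) → GA p G → ⊨A G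
mainTheorem9 p G d v = Any.map (Holds⇒SeqTrue v) (sound v d)
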